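{- For all $n\in\mathbb{N}$ and all formulas $A_1,\dots,A_n,B$ of $\mathcal{L}_D$, $$\vDash D(A_1,\dots,A_n;B)\leftrightarrow\bigwedge_{T\subseteq\{1,\dots,n\}}\big(\Delta(B_T\to B)\vee\Delta(B_T\to\neg B)\big).$$
   Context: Kripke models are $\mathcal{M}=\langle W,R,V\rangle$ with $W$ nonempty, $R\subseteq W\times W$ an arbitrary binary relation, $V$ a valuation. $\mathcal{L}_D$: $A::=p\mid\neg A\mid A\land A\mid D(A_1,\dots,A_n;A)$ for any $n\in\mathbb{N}$, with $\mathcal{M},w\vDash D(A_1,\dots,A_n;B)$ iff for all $u,v\in W$ with $wRu$ and $wRv$, if ($\mathcal{M},u\vDash A_i\iff\mathcal{M},v\vDash A_i$) for all $i\le n$, then ($\mathcal{M},u\vDash B\iff\mathcal{M},v\vDash B$). $\Delta B$ denotes $D(\,;B)$ (the case $n=0$), so $\mathcal{M},w\vDash\Delta B$ iff all $R$-successors of $w$ agree on the truth of $B$. For $T\subseteq\{1,\dots,n\}$, $B_T$ is the conjunction $C_1\land\cdots\land C_n$ where $C_i=A_i$ if $i\in T$ and $C_i=\neg A_i$ otherwise (the empty conjunction being $\top$). $\vDash$ denotes truth at every world of every Kripke model. -}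

module Defs where

open import Level using (0ℓ)
open import Data.Nat using (ℕ; zero; suc)
open import Data.Bool using (Bool; true; false)
open import Data.Vec using (Vec; []; _∷_)
open import Data.List using (List; []; _∷_; map; _++_)
open import Data.Product using (_×_)
open import Data.Empty using (⊥)
open import Relation.Nullary using (¬_)
open import Function.Bundles using (_⇔_)

data Form : Set
infixr 6 _∧'_
infix 7 ¬'_
infixr 5 _∨'_
infixr 4 _→'_
infix 3 _↔'_
data Form where
  var  : ℕ → Form
  ¬'_  : Form → Form
  _∧'_ : Form → Form → Form
  D    : {n : ℕ} → Vec Form n → Form → Form


⊤' : Form
⊤' = ¬' (var 0 ∧' ¬' var 0)

_→'_ : Form → Form → Form
A →' B = ¬' (A ∧' ¬' B)

_∨'_ : Form → Form → Form
A ∨' B = ¬' (¬' A ∧' ¬' B)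

_↔'_ : Form → Form → Form
A ↔' B = (A →' B) ∧' (B →' A)

Δ : Form → Form
Δ B = D [] B

record Model : Set₁ where
  field
    W : Set
    R : W → W → Set
    V : ℕ → W → Set
open Model public

mutual
  sat : (M : Model) → W M → Form → Set
  sat M w (var p) = V M p w
  sat M w (¬' A) = ¬ sat M w A
  sat M w (A ∧' B) = sat M w A × sat M w B
  sat M w (D As B) = (u v : W M) → R M w u → R M w v →
                     agree M u v As → (sat M u B ⇔ sat M v B)

  agree : (M : Model) → W M → W M → {n : ℕ} → Vec Form n → Set
  agree M u v [] = Data.Unit.⊤ where import Data.Unit
  agree M u v (A ∷ As) = (sat M u A ⇔ sat M v A) × agree M u v As

⊨_ : Form → Set₁
⊨ A = (M : Model) (w : W M) → sat M w A

⋀ : List Form → Form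
⋀ [] = ⊤'
⋀ (A ∷ []) = A
⋀ (A ∷ As@(_ ∷ _)) = A ∧' ⋀ As

-- subsets T ⊆ {1..n} as characteristic vectors; all 2^n of them
allSubsets : (n : ℕ) → List (Vec Bool n)
allSubsets zero = [] ∷ []
allSubsets (suc n) = map (true ∷_) (allSubsets n) ++ map (false ∷_) (allSubsets n)

literals : {n : ℕ} → Vec Form n → Vec Bool n → List Form
literals [] [] = []
literals (A ∷ As) (true ∷ T) = A ∷ literals As T
literals (A ∷ As) (false ∷ T) = ¬' A ∷ literals As T

B[_,_] : {n : ℕ} → Vec Form n → Vec Bool n → Form
B[ As , T ] = ⋀ (literals As T)

rhs : {n : ℕ} → Vec Form n → Form → Form
rhs {n} As B = ⋀ (map (λ T → Δ (B[ As , T ] →' B) ∨' Δ (B[ As , T ] →' ¬' B)) (allSubsets n))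

module Submission where

-- Semantically a subset T is a "type": a world u realizes T when it satisfies
-- exactly the literals of B_T.  Classically every world realizes some T, and
-- two worlds agree on A₁,…,Aₙ iff they realize the same T.  Hence
-- D(A⃗;B) holds at w iff, for each T, B is constant on the T-realizing
-- successors of w, and this is what the T-clause expresses: either every
-- T-successor satisfies B_T → B, or every one satisfies B_T → ¬B.
--
-- Excluded
-- middle classifies worlds into types and decides the remaining cases.

open import Level using (0ℓ)
open import Data.Nat using (ℕ; zero; suc)
open import Data.Vec using (Vec; []; _∷_)
open import Data.Bool using (Bool; true; false)
open import Data.List using (List; []; _∷_; map)
open import Data.List.Relation.Unary.All using (All; []; _∷_; tabulate; lookup)
open import Data.List.Relation.Unary.All.Properties using (map⁺; map⁻)
open import Data.List.Relation.Unary.Any using (here)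
open import Data.List.Membership.Propositional using (_∈_)
open import Data.List.Membership.Propositional.Properties using (∈-++⁺ˡ; ∈-++⁺ʳ; ∈-map⁺)
open import Relation.Binary.PropositionalEquality using (refl)
open import Data.Product using (Σ; ∃; _×_; _,_)
open import Data.Empty using (⊥-elim)
open import Data.Unit using (tt)
open import Relation.Nullary using (yes; no; ¬_)
open import Function.Bundles using (mk⇔; Equivalence)
open import Axiom.ExcludedMiddle using (ExcludedMiddle)
open import Defs

allSubsets-complete : (n : ℕ) (T : Vec Bool n) → T ∈ allSubsets n
allSubsets-complete zero [] = here refl
allSubsets-complete (suc n) (true ∷ T) =
  ∈-++⁺ˡ (∈-map⁺ (true ∷_) (allSubsets-complete n T))
allSubsets-complete (suc n) (false ∷ T) =
  ∈-++⁺ʳ (map (true ∷_) (allSubsets n)) (∈-map⁺ (false ∷_) (allSubsets-complete n T))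

module Connectives (M : Model) where

  ⋀-elim : ∀ {w} (L : List Form) → sat M w (⋀ L) → All (sat M w) L
  ⋀-elim [] _ = []
  ⋀-elim (A ∷ []) a = a ∷ []
  ⋀-elim (A ∷ L@(_ ∷ _)) (a , as) = a ∷ ⋀-elim L as

  ⋀-intro : ∀ {w} (L : List Form) → All (sat M w) L → sat M w (⋀ L)
  ⋀-intro [] [] (p , ¬p) = ¬p p
  ⋀-intro (A ∷ []) (a ∷ []) = a
  ⋀-intro (A ∷ L@(_ ∷ _)) (a ∷ as) = a , ⋀-intro L as

  -- Introduction rules for the classically defined connectives; they hold
  -- constructively since each connective unfolds to a negation.
  →'-intro : ∀ {w} A B → (sat M w A → sat M w B) → sat M w (A →' B)
  →'-intro A B f (a , ¬b) = ¬b (f a)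

  ↔'-intro : ∀ {w} A B → (sat M w A → sat M w B) → (sat M w B → sat M w A) →
             sat M w (A ↔' B)
  ↔'-intro A B f g = →'-intro A B f , →'-intro B A g

  ∨'-introˡ : ∀ {w} A B → sat M w A → sat M w (A ∨' B)
  ∨'-introˡ A B a (¬a , _) = ¬a a

  ∨'-introʳ : ∀ {w} A B → sat M w B → sat M w (A ∨' B)
  ∨'-introʳ A B b (_ , ¬b) = ¬b b

  Δ-intro : ∀ {w} C → (∀ u → R M w u → sat M u C) → sat M w (Δ C)
  Δ-intro C all u v wu wv _ = mk⇔ (λ _ → all v wv) (λ _ → all u wu)

  Δ-transfer : ∀ {w x y} C → sat M w (Δ C) → R M w x → R M w y →
               sat M x C → sat M y C
  Δ-transfer C δ wx wy = Equivalence.to (δ _ _ wx wy tt)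

module Types (M : Model) where
  open Connectives M

  Realizes : W M → {n : ℕ} → Vec Form n → Vec Bool n → Set
  Realizes u As T = All (sat M u) (literals As T)

  B[]⇒realizes : ∀ {u n} (As : Vec Form n) T → sat M u B[ As , T ] → Realizes u As T
  B[]⇒realizes As T = ⋀-elim (literals As T)

  realizes⇒B[] : ∀ {u n} (As : Vec Form n) T → Realizes u As T → sat M u B[ As , T ]
  realizes⇒B[] As T = ⋀-intro (literals As T)

  type-of : ExcludedMiddle 0ℓ → ∀ u {n} (As : Vec Form n) → ∃ (Realizes u As)
  type-of lem u [] = [] , []
  type-of lem u (A ∷ As) with type-of lem u As | lem {sat M u A}
  ... | T , r | yes a = true ∷ T , a ∷ r
  ... | T , r | no ¬a = false ∷ T , ¬a ∷ r

  agree⇒realizes : ∀ {u v n} (As : Vec Form n) (T : Vec Bool n) →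
                   agree M u v As → Realizes u As T → Realizes v As T
  agree⇒realizes [] [] _ _ = []
  agree⇒realizes (A ∷ As) (true ∷ T) (e , ag) (a ∷ r) =
    Equivalence.to e a ∷ agree⇒realizes As T ag r
  agree⇒realizes (A ∷ As) (false ∷ T) (e , ag) (¬a ∷ r) =
    (λ a → ¬a (Equivalence.from e a)) ∷ agree⇒realizes As T ag r

  realizes⇒agree : ∀ {u v n} (As : Vec Form n) (T : Vec Bool n) →
                   Realizes u As T → Realizes v As T → agree M u v As
  realizes⇒agree [] [] _ _ = tt
  realizes⇒agree (A ∷ As) (true ∷ T) (a ∷ r) (a' ∷ r') =
    mk⇔ (λ _ → a') (λ _ → a) , realizes⇒agree As T r r'
  realizes⇒agree (A ∷ As) (false ∷ T) (¬a ∷ r) (¬a' ∷ r') =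
    mk⇔ (λ a → ⊥-elim (¬a a)) (λ a' → ⊥-elim (¬a' a')) , realizes⇒agree As T r r'

  agree-sym : ∀ {u v n} (As : Vec Form n) → agree M u v As → agree M v u As
  agree-sym [] _ = tt
  agree-sym (A ∷ As) (e , ag) =
    mk⇔ (Equivalence.from e) (Equivalence.to e) , agree-sym As ag

clause : {n : ℕ} → Vec Form n → Form → Vec Bool n → Form
clause As B T = Δ (B[ As , T ] →' B) ∨' Δ (B[ As , T ] →' ¬' B)

module Characterization (M : Model) (lem : ExcludedMiddle 0ℓ)
                        {n : ℕ} (As : Vec Form n) (B : Form) where
  open Connectives M
  open Types M

  uniform-B⇒clause : ∀ {w} T → (∀ v → R M w v → Realizes v As T → sat M v B) →
                     sat M w (clause As B T)
  uniform-B⇒clause {w} T all =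
    ∨'-introˡ (Δ (B[ As , T ] →' B)) (Δ (B[ As , T ] →' ¬' B)) Δ-B
    where
    Δ-B : sat M w (Δ (B[ As , T ] →' B))
    Δ-B = Δ-intro (B[ As , T ] →' B) λ v wv → →'-intro B[ As , T ] B λ bt →
            all v wv (B[]⇒realizes As T bt)

  uniform-¬B⇒clause : ∀ {w} T → (∀ v → R M w v → Realizes v As T → ¬ sat M v B) →
                      sat M w (clause As B T)
  uniform-¬B⇒clause {w} T none =
    ∨'-introʳ (Δ (B[ As , T ] →' B)) (Δ (B[ As , T ] →' ¬' B)) Δ-¬B
    where
    Δ-¬B : sat M w (Δ (B[ As , T ] →' ¬' B))
    Δ-¬B = Δ-intro (B[ As , T ] →' ¬' B) λ v wv → →'-intro B[ As , T ] (¬' B) λ bt →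
             none v wv (B[]⇒realizes As T bt)

  -- If D(A⃗;B) holds, each clause holds: either some T-successor satisfies
  -- B, and then all do since they agree on A⃗, or none does.
  D⇒clause : ∀ {w} → sat M w (D As B) → ∀ T → sat M w (clause As B T)
  D⇒clause {w} d T with lem {Σ (W M) λ u → R M w u × Realizes u As T × sat M u B}
  ... | yes (u , wu , ru , bu) = uniform-B⇒clause T λ v wv rv →
          Equivalence.to (d u v wu wv (realizes⇒agree As T ru rv)) bu
  ... | no none = uniform-¬B⇒clause T λ v wv rv bv → none (v , wv , rv , bv)

  -- Conversely the T-clause forbids B at one T-successor and ¬B at another:
  -- the first disjunct would carry B_T → B from x to y, the second would carry
  -- B_T → ¬B from y to x.
  clause⇒uniform : ∀ {w x y} T → sat M w (clause As B T) →
                   R M w x → R M w y → Realizes x As T → Realizes y As T →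
                   sat M x B → ¬ ¬ sat M y B
  clause⇒uniform T cl wx wy rx ry bx ¬by = cl (refute-B , refute-¬B)
    where
    refute-B : ¬ sat M _ (Δ (B[ As , T ] →' B))
    refute-B δ = Δ-transfer (B[ As , T ] →' B) δ wx wy
                   (→'-intro B[ As , T ] B λ _ → bx)
                   (realizes⇒B[] As T ry , ¬by)
    refute-¬B : ¬ sat M _ (Δ (B[ As , T ] →' ¬' B))
    refute-¬B δ = Δ-transfer (B[ As , T ] →' ¬' B) δ wy wx
                    (→'-intro B[ As , T ] (¬' B) λ _ → ¬by)
                    (realizes⇒B[] As T rx , λ ¬bx → ¬bx bx)

  -- Hence, if all clauses hold, B passes between successors agreeing on A⃗:
  -- both realize the type of the first one.
  clauses⇒preserve : ∀ {w} → (∀ T → sat M w (clause As B T)) →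
                     ∀ {x y} → R M w x → R M w y → agree M x y As →
                     sat M x B → sat M y B
  clauses⇒preserve h {x} {y} wx wy ag bx with type-of lem x As | lem {sat M y B}
  ... | _ | yes by = by
  ... | T , rx | no ¬by =
    ⊥-elim (clause⇒uniform T (h T) wx wy rx (agree⇒realizes As T ag rx) bx ¬by)

  clauses⇒D : ∀ {w} → (∀ T → sat M w (clause As B T)) → sat M w (D As B)
  clauses⇒D h u v wu wv ag =
    mk⇔ (clauses⇒preserve h wu wv ag) (clauses⇒preserve h wv wu (agree-sym As ag))

  clauses⇒rhs : ∀ {w} → (∀ T → sat M w (clause As B T)) → sat M w (rhs As B)
  clauses⇒rhs h =
    ⋀-intro (map (clause As B) (allSubsets n)) (map⁺ (tabulate λ {T} _ → h T))

  rhs⇒clauses : ∀ {w} → sat M w (rhs As B) → ∀ T → sat M w (clause As B T)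
  rhs⇒clauses {w} r T = lookup {P = λ T → sat M w (clause As B T)}
    (map⁻ (⋀-elim (map (clause As B) (allSubsets n)) r)) (allSubsets-complete n T)

proposition6p4 : ExcludedMiddle 0ℓ → (n : ℕ) (As : Vec Form n) (B : Form) →
    ⊨ (D As B ↔' rhs As B)
proposition6p4 lem n As B M w =
  ↔'-intro (D As B) (rhs As B)
    (λ d → clauses⇒rhs (D⇒clause d))
    (λ r → clauses⇒D (rhs⇒clauses r))
  where
  open Connectives M
  open Characterization M lem As B
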